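{- Let $X$ be a nonempty set equipped with a topology $\Omega$, a partial order $\le$ and an equivalence relation $E$. Then $(X,\Omega,\le,E)$ is an mq-space if and only if it is an mk-frame.
   Context: Notation: $E(Z)=\{y:(x,y)\in E$ for some $x\in Z\}$, $E(x)=E(\{x\})$; $(Y]$ is the down-set generated by $Y$. A Priestley space is a compact space with a partial order such that whenever $x\not\le y$ there is a clopen increasing $U$ with $x\in U$, $y\notin U$; $D(X)$ is the set of clopen increasing subsets. A q-space is $(X,E)$ with $X$ Priestley and $E$ an equivalence relation with $E(U)\in D(X)$ for $U\in D(X)$ and every class $E(x)$ closed. An mq-space is a q-space with (mq1) $(x,y)\in E$, $y\le z$ imply some $w$ with $x\le w$, $(w,z)\in E$; (mq2) $(E(X\setminus V)]$ clopen for all $V\in D(X)$. An mk-frame is $(X,\Omega,\le,E)$ with $(X,\le)$ a nonempty poset, $E$ an equivalence relation, and: (mk1) whenever $(x,z)\in E$ and $z\le y$ there is $w$ with $x\le w$ and $(w,y)\in E$; (mk2) $(X,\Omega,\le)$ is a Priestley space; (mk3) $E(A)$ is closed for all closed $A\subseteq X$; (mk4) $E(U)$ is open for all $U\in D(X)$; (mk5) $(E(X\setminus U)]$ is open for all $U\in D(X)$. -}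

module Defs where

open import Level using (0ℓ)
open import Data.Nat using (ℕ)
open import Data.Fin using (Fin)
open import Data.Product using (Σ; ∃; _×_; _,_)
open import Relation.Nullary using (¬_)
open import Relation.Unary using (Pred; _∈_; _∉_; ∁; _≐_; ｛_｝)
open import Relation.Binary.PropositionalEquality using (_≡_)

Subset : Set → Set₁
Subset X = Pred X 0ℓ

⋃ : {X I : Set} → (I → Subset X) → Subset X
⋃ {I = I} U x = Σ I λ i → x ∈ U i

_∩_ : {X : Set} → Subset X → Subset X → Subset X
(A ∩ B) x = x ∈ A × x ∈ B

Whole : {X : Set} → Subset X
Whole x = Level.Lift 0ℓ Data.Unit.⊤
  where import Data.Unit

-- A topology on X, given by its family of open sets.  Since subsets are
-- predicates, we require openness to respect extensional equality of subsets.
record Topology (X : Set) : Set₁ where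
  field
    Open      : Subset X → Set
    Open-resp : {U V : Subset X} → U ≐ V → Open U → Open V
    Open-X    : Open Whole
    Open-∩    : {U V : Subset X} → Open U → Open V → Open (U ∩ V)
    Open-⋃    : {I : Set} (U : I → Subset X) → (∀ i → Open (U i)) → Open (⋃ U)

module _ {X : Set} (T : Topology X) where
  open Topology T

  Closed : Subset X → Set
  Closed A = Open (∁ A)

  Clopen : Subset X → Set
  Clopen A = Open A × Closed A

  Compact : Set₁
  Compact = {I : Set} (U : I → Subset X) → (∀ i → Open (U i)) →
            (∀ x → ∃ λ i → x ∈ U i) →
            ∃ λ (n : ℕ) → ∃ λ (f : Fin n → I) → ∀ x → ∃ λ k → x ∈ U (f k)

module _ {X : Set} (_≤_ : X → X → Set) where

  Increasing : Subset X → Set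
  Increasing U = ∀ {x y} → x ≤ y → x ∈ U → y ∈ U

  Down : Subset X → Subset X
  Down Y x = ∃ λ y → y ∈ Y × x ≤ y

Img : {X : Set} → (X → X → Set) → Subset X → Subset X
Img E Z y = ∃ λ x → x ∈ Z × E x y

module _ {X : Set} (T : Topology X) (_≤_ : X → X → Set) where
  open Topology T

  D : Subset X → Set
  D U = Clopen T U × Increasing _≤_ U

  record Priestley : Set₁ where
    field
      compact    : Compact T
      separation : ∀ x y → ¬ (x ≤ y) → ∃ λ U → D U × x ∈ U × y ∉ U

  module _ (E : X → X → Set) where

    record QSpace : Set₁ where
      field
        priestley : Priestley
        E-D       : ∀ U → D U → D (Img E U)
        E-class   : ∀ x → Closed T (Img E ｛ x ｝)

    record MQSpace : Set₁ where
      field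
        qspace : QSpace
        mq1    : ∀ {x y z} → E x y → y ≤ z → ∃ λ w → x ≤ w × E w z
        mq2    : ∀ V → D V → Clopen T (Down _≤_ (Img E (∁ V)))

    record MKFrame : Set₁ where
      field
        mk1 : ∀ {x y z} → E x z → z ≤ y → ∃ λ w → x ≤ w × E w y
        mk2 : Priestley
        mk3 : ∀ A → Closed T A → Closed T (Img E A)
        mk4 : ∀ U → D U → Open (Img E U)
        mk5 : ∀ U → D U → Open (Down _≤_ (Img E (∁ U)))

-- Only mk3 needs an argument.  Conversely, E-classes are images of the closed
-- singletons, and (E(X∖V)] is the down-set of the closed set E(X∖V), which is closed
-- by Priestley separation and compactness.
--
-- For mk3 let A be closed and y ∉ E(A).  Unless y lies below E(a) and a lies below
-- E(y), a clopen up-set separates them and its E-image yields disjoint neighbourhoods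
-- of a and y; compactness then separates y from E(A).  In the remaining case mq1
-- makes the closed classes E(a) and E(y) cofinal in each other, and the supremum of a
-- monotone sequence zig-zagging between them lies in both, so (a, y) ∈ E.  Such
-- suprema exist in every Priestley space by compactness, which avoids Zorn's lemma.
module Submission where

open import Defs
open import Level using (0ℓ; lift)
open import Axiom.ExcludedMiddle using (ExcludedMiddle)
open import Axiom.DoubleNegationElimination using (em⇒dne)
open import Function.Bundles using (_⇔_; mk⇔)
open import Relation.Binary.Structures using (IsPartialOrder; IsEquivalence)
open import Relation.Binary.PropositionalEquality using (_≡_; refl; subst)
open import Data.Nat as ℕ using (ℕ; zero; suc; _⊔_; _≤′_; ≤′-refl; ≤′-step)
import Data.Nat.Properties as ℕ
open import Data.Fin using (Fin; zero; suc)
open import Data.Product using (Σ; ∃; _×_; _,_; proj₁; proj₂)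
open import Data.Sum using (_⊎_; inj₁; inj₂)
open import Data.Unit using (⊤; tt)
open import Data.Empty using (⊥; ⊥-elim)
open import Relation.Nullary using (¬_; yes; no)
open import Relation.Unary using (_∈_; _∉_; ∁; ｛_｝; _⊆_)

finite-max : {n : ℕ} → (Fin n → ℕ) → ℕ
finite-max {zero}  f = 0
finite-max {suc n} f = f zero ⊔ finite-max (λ k → f (suc k))

≤-finite-max : {n : ℕ} (f : Fin n → ℕ) (k : Fin n) → f k ℕ.≤ finite-max f
≤-finite-max f zero    = ℕ.m≤m⊔n _ _
≤-finite-max f (suc k) = ℕ.≤-trans (≤-finite-max (λ k → f (suc k)) k) (ℕ.m≤n⊔m _ _)

module Classical (lem : ExcludedMiddle 0ℓ) where

  dne : {P : Set} → ¬ ¬ P → P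
  dne = em⇒dne lem

  ¬∀⇒∃¬ : {A : Set} {P : A → Set} → ¬ (∀ a → P a) → ∃ λ a → ¬ P a
  ¬∀⇒∃¬ ¬∀ = dne λ ¬∃ → ¬∀ λ a → dne λ ¬Pa → ¬∃ (a , ¬Pa)

  ¬⇒⇒×¬ : {A B : Set} → ¬ (A → B) → A × ¬ B
  ¬⇒⇒×¬ ¬A⇒B = dne (λ ¬A → ¬A⇒B (λ a → ⊥-elim (¬A a))) , (λ b → ¬A⇒B (λ _ → b))

module TopologyFacts (lem : ExcludedMiddle 0ℓ) {X : Set} (Ω : Topology X) where
  open Topology Ω
  open Classical lem

  ⋂ᶠ : {n : ℕ} → (Fin n → Subset X) → Subset X
  ⋂ᶠ W x = ∀ k → x ∈ W k

  Open-local : (S : Subset X) →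
    (∀ x → x ∈ S → Σ (Subset X) λ O → Open O × x ∈ O × O ⊆ S) → Open S
  Open-local S nbhd = Open-resp (⋃U⊆S , S⊆⋃U) (Open-⋃ U (λ (x , x∈S) → proj₁ (proj₂ (nbhd x x∈S))))
    where
    U : Σ X (_∈ S) → Subset X
    U (x , x∈S) = proj₁ (nbhd x x∈S)
    ⋃U⊆S : ⋃ U ⊆ S
    ⋃U⊆S ((x , x∈S) , y∈U) = proj₂ (proj₂ (proj₂ (nbhd x x∈S))) y∈U
    S⊆⋃U : S ⊆ ⋃ U
    S⊆⋃U {x} x∈S = (x , x∈S) , proj₁ (proj₂ (proj₂ (nbhd x x∈S)))

  Open-∅ : Open (∁ Whole)
  Open-∅ = Open-resp ((λ { (() , _) }) , (λ ∉Whole → ⊥-elim (∉Whole (lift tt))))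
                     (Open-⋃ {I = ⊥} (λ ()) (λ ()))

  Open-⋂ᶠ : {n : ℕ} (W : Fin n → Subset X) → (∀ k → Open (W k)) → Open (⋂ᶠ W)
  Open-⋂ᶠ {zero}  W open-W = Open-resp ((λ _ ()) , (λ _ → lift tt)) Open-X
  Open-⋂ᶠ {suc n} W open-W = Open-resp
    ( (λ (x∈W₀ , x∈Wₛ) → λ { zero → x∈W₀ ; (suc k) → x∈Wₛ k })
    , (λ x∈W → x∈W zero , (λ k → x∈W (suc k))))
    (Open-∩ (open-W zero) (Open-⋂ᶠ (λ k → W (suc k)) (λ k → open-W (suc k))))

  Open⇒Closed-∁ : {A : Subset X} → Open A → Closed Ω (∁ A)
  Open⇒Closed-∁ = Open-resp ((λ a ¬a → ¬a a) , dne)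

  Closed-⋂ᶠ : {n : ℕ} (W : Fin n → Subset X) → (∀ k → Closed Ω (W k)) → Closed Ω (⋂ᶠ W)
  Closed-⋂ᶠ W closed-W = Open-local _ λ x x∉⋂W →
    let (k , x∉Wₖ) = ¬∀⇒∃¬ x∉⋂W in ∁ (W k) , closed-W k , x∉Wₖ , (λ y∉Wₖ y∈⋂W → y∉Wₖ (y∈⋂W k))

module PriestleyFacts (lem : ExcludedMiddle 0ℓ) {X : Set} (Ω : Topology X) (_≤_ : X → X → Set)
  (po : IsPartialOrder _≡_ _≤_) (pr : Priestley Ω _≤_) where
  open Topology Ω
  open Priestley pr
  open Classical lem
  open TopologyFacts lem Ω public
  module PO = IsPartialOrder po

  D-open : ∀ {U} → D Ω _≤_ U → Open U
  D-open ((open-U , _) , _) = open-U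

  D-closed : ∀ {U} → D Ω _≤_ U → Closed Ω U
  D-closed ((_ , closed-U) , _) = closed-U

  D-increasing : ∀ {U} → D Ω _≤_ U → Increasing _≤_ U
  D-increasing (_ , increasing-U) = increasing-U

  D-Whole : D Ω _≤_ Whole
  D-Whole = (Open-X , Open-∅) , (λ _ _ → lift tt)

  D-⋂ᶠ : {n : ℕ} (W : Fin n → Subset X) → (∀ k → D Ω _≤_ (W k)) → D Ω _≤_ (⋂ᶠ W)
  D-⋂ᶠ W W-D = (Open-⋂ᶠ W (λ k → D-open (W-D k)) , Closed-⋂ᶠ W (λ k → D-closed (W-D k)))
             , (λ x≤y x∈W k → D-increasing (W-D k) x≤y (x∈W k))

  sep : ∀ {x y} → ¬ x ≤ y → Subset X
  sep x≰y = proj₁ (separation _ _ x≰y)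

  sep-D : ∀ {x y} (x≰y : ¬ x ≤ y) → D Ω _≤_ (sep x≰y)
  sep-D x≰y = proj₁ (proj₂ (separation _ _ x≰y))

  ∈sep : ∀ {x y} (x≰y : ¬ x ≤ y) → x ∈ sep x≰y
  ∈sep x≰y = proj₁ (proj₂ (proj₂ (separation _ _ x≰y)))

  ∉sep : ∀ {x y} (x≰y : ¬ x ≤ y) → y ∉ sep x≰y
  ∉sep x≰y = proj₂ (proj₂ (proj₂ (separation _ _ x≰y)))

  -- Cover X by ∁F and by the complements of the sets separating p from each t ∈ F;
  -- the pieces of a finite subcover give finitely many clopen up-sets to intersect.
  separate-from-closed : (p : X) (F : Subset X) → Closed Ω F → (∀ t → t ∈ F → ¬ p ≤ t) →
    Σ (Subset X) λ U → D Ω _≤_ U × p ∈ U × (∀ u → u ∈ U → u ∉ F)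
  separate-from-closed p F closed-F p≰F =
    let (n , f , finite-cover) = compact cover open-cover covers
    in ⋂ᶠ (λ k → piece (f k)) , D-⋂ᶠ _ (λ k → piece-D (f k)) , (λ k → p∈piece (f k)) ,
       λ u u∈⋂ u∈F → let (k , u∈cover) = finite-cover u in piece-misses (f k) u∈F (u∈⋂ k) u∈cover
    where
    Index : Set
    Index = ⊤ ⊎ Σ X (_∈ F)
    piece : Index → Subset X
    piece (inj₁ _)         = Whole
    piece (inj₂ (t , t∈F)) = sep (p≰F t t∈F)
    cover : Index → Subset X
    cover (inj₁ _) = ∁ F
    cover (inj₂ i) = ∁ (piece (inj₂ i))
    open-cover : ∀ i → Open (cover i)
    open-cover (inj₁ _)         = closed-F
    open-cover (inj₂ (t , t∈F)) = D-closed (sep-D (p≰F t t∈F))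
    covers : ∀ x → ∃ λ i → x ∈ cover i
    covers x with lem {x ∈ F}
    ... | yes x∈F = inj₂ (x , x∈F) , ∉sep (p≰F x x∈F)
    ... | no  x∉F = inj₁ tt , x∉F
    piece-D : ∀ i → D Ω _≤_ (piece i)
    piece-D (inj₁ _)         = D-Whole
    piece-D (inj₂ (t , t∈F)) = sep-D (p≰F t t∈F)
    p∈piece : ∀ i → p ∈ piece i
    p∈piece (inj₁ _)         = lift tt
    p∈piece (inj₂ (t , t∈F)) = ∈sep (p≰F t t∈F)
    piece-misses : ∀ i {u} → u ∈ F → u ∈ piece i → u ∉ cover i
    piece-misses (inj₁ _) u∈F _    u∉F    = u∉F u∈F
    piece-misses (inj₂ _) _   u∈sep u∉sep = u∉sep u∈sep

  Down-closed : {F : Subset X} → Closed Ω F → Closed Ω (Down _≤_ F)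
  Down-closed {F} closed-F = Open-local _ λ x x∉↓F →
    let (U , U-D , x∈U , U∩F=∅) = separate-from-closed x F closed-F (λ t t∈F x≤t → x∉↓F (t , t∈F , x≤t))
    in U , D-open U-D , x∈U , λ u∈U (t , t∈F , u≤t) → U∩F=∅ t (D-increasing U-D u≤t u∈U) t∈F

  singleton-closed : ∀ x → Closed Ω ｛ x ｝
  singleton-closed x = Open-local _ nbhd
    where
    nbhd : ∀ y → y ∉ ｛ x ｝ → Σ (Subset X) λ O → Open O × y ∈ O × O ⊆ ∁ ｛ x ｝
    nbhd y x≢y with lem {x ≤ y}
    ... | no x≰y  = ∁ (sep x≰y) , D-closed (sep-D x≰y) , ∉sep x≰y , λ { x∉ refl → x∉ (∈sep x≰y) }
    ... | yes x≤y = sep y≰x , D-open (sep-D y≰x) , ∈sep y≰x , λ { x∈ refl → ∉sep y≰x x∈ }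
      where
      y≰x : ¬ y ≤ x
      y≰x y≤x = x≢y (PO.antisym x≤y y≤x)

  record AvoidedNbhd (g : ℕ → X) (x : X) : Set₁ where
    field
      nbhd      : Subset X
      open-nbhd : Open nbhd
      centre    : x ∈ nbhd
      threshold : ℕ
      avoided   : ∀ m → threshold ℕ.≤ m → g m ∉ nbhd

  -- Finitely many of the neighbourhoods cover X, yet g m lies in none of them once
  -- m exceeds all their thresholds.
  ¬all-avoided : (g : ℕ → X) → ¬ (∀ x → AvoidedNbhd g x)
  ¬all-avoided g nbhds =
    let open AvoidedNbhd
        (n , f , finite-cover) = compact (λ x → nbhd (nbhds x)) (λ x → open-nbhd (nbhds x))
                                         (λ x → x , centre (nbhds x))
        thresholds = λ k → threshold (nbhds (f k))
        (k , g∈nbhd) = finite-cover (g (finite-max thresholds))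
    in avoided (nbhds (f k)) _ (≤-finite-max thresholds k) g∈nbhd

  Monotone : (ℕ → X) → Set
  Monotone g = ∀ {m n} → m ℕ.≤ n → g m ≤ g n

  monotone-stepwise : (g : ℕ → X) → (∀ n → g n ≤ g (suc n)) → Monotone g
  monotone-stepwise g step m≤n = go (ℕ.≤⇒≤′ m≤n)
    where
    go : ∀ {m n} → m ≤′ n → g m ≤ g n
    go ≤′-refl        = PO.refl
    go (≤′-step m≤′n) = PO.trans (go m≤′n) (step _)

  -- An upper bound of g that no separating set of the Priestley axiom separates from
  -- g; it is then the least upper bound of g.
  IsSup : (ℕ → X) → X → Set
  IsSup g s = (∀ n → g n ≤ s) × (∀ x y (x≰y : ¬ x ≤ y) → s ∈ sep x≰y → ∃ λ m → g m ∈ sep x≰y)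

  monotone⇒sup : (g : ℕ → X) → Monotone g → ∃ (IsSup g)
  monotone⇒sup g mono = dne λ ¬sup → ¬all-avoided g (avoided-nbhd ¬sup)
    where
    avoided-nbhd : ¬ ∃ (IsSup g) → ∀ x → AvoidedNbhd g x
    avoided-nbhd ¬sup x with lem {∃ λ n → ¬ g n ≤ x}
    ... | yes (n , gₙ≰x) = record
      { nbhd = ∁ (sep gₙ≰x) ; open-nbhd = D-closed (sep-D gₙ≰x) ; centre = ∉sep gₙ≰x
      ; threshold = n ; avoided = λ m n≤m gₘ∉ → gₘ∉ (D-increasing (sep-D gₙ≰x) (mono n≤m) (∈sep gₙ≰x)) }
    ... | no ¬∃gₙ≰x =
      let upper = λ n → dne λ gₙ≰x → ¬∃gₙ≰x (n , gₙ≰x)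
          (u , ¬meets₁) = ¬∀⇒∃¬ λ meets → ¬sup (x , upper , meets)
          (v , ¬meets₂) = ¬∀⇒∃¬ ¬meets₁
          (u≰v , ¬meets) = ¬∀⇒∃¬ ¬meets₂
          (x∈sep , ¬meet) = ¬⇒⇒×¬ ¬meets
      in record { nbhd = sep u≰v ; open-nbhd = D-open (sep-D u≰v) ; centre = x∈sep
                ; threshold = 0 ; avoided = λ m _ gₘ∈sep → ¬meet (m , gₘ∈sep) }

  sup∈closed : ∀ {g s F} → Monotone g → IsSup g s → Closed Ω F → (∀ m → g m ∈ F) → s ∈ F
  sup∈closed {g} {s} {F} mono (upper , meets) closed-F g∈F = dne λ s∉F → ¬all-avoided g (avoided-nbhd s∉F)
    where
    avoided-nbhd : s ∉ F → ∀ x → AvoidedNbhd g x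
    avoided-nbhd s∉F x with lem {x ∈ F}
    ... | no x∉F = record { nbhd = ∁ F ; open-nbhd = closed-F ; centre = x∉F
                          ; threshold = 0 ; avoided = λ m _ gₘ∉F → gₘ∉F (g∈F m) }
    ... | yes x∈F with lem {s ≤ x}
    ... | yes s≤x = record { nbhd = sep x≰s ; open-nbhd = D-open (sep-D x≰s) ; centre = ∈sep x≰s
                           ; threshold = 0 ; avoided = λ m _ gₘ∈ → ∉sep x≰s (D-increasing (sep-D x≰s) (upper m) gₘ∈) }
      where
      x≰s : ¬ x ≤ s
      x≰s x≤s = s∉F (subst (_∈ F) (PO.antisym x≤s s≤x) x∈F)
    ... | no s≰x =
      let (N , g_N∈) = meets s x s≰x (∈sep s≰x)
      in record { nbhd = ∁ (sep s≰x) ; open-nbhd = D-closed (sep-D s≰x) ; centre = ∉sep s≰x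
                ; threshold = N ; avoided = λ m N≤m gₘ∉ → gₘ∉ (D-increasing (sep-D s≰x) (mono N≤m) g_N∈) }

  cofinal-closed-meet : {C C′ : Subset X} → Closed Ω C → Closed Ω C′ → ∀ {c₀} → c₀ ∈ C →
    C ⊆ Down _≤_ C′ → C′ ⊆ Down _≤_ C → ∃ λ s → s ∈ (C ∩ C′)
  cofinal-closed-meet {C} {C′} closed-C closed-C′ {c₀} c₀∈C C≤C′ C′≤C =
    s , sup∈closed e-mono sup-e closed-C e∈C , sup∈closed o-mono sup-o closed-C′ o∈C′
    where
    e o : ℕ → X
    e∈C : ∀ n → e n ∈ C
    o∈C′ : ∀ n → o n ∈ C′
    e zero    = c₀
    e (suc n) = proj₁ (C′≤C (o∈C′ n))
    e∈C zero    = c₀∈C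
    e∈C (suc n) = proj₁ (proj₂ (C′≤C (o∈C′ n)))
    o n    = proj₁ (C≤C′ (e∈C n))
    o∈C′ n = proj₁ (proj₂ (C≤C′ (e∈C n)))

    e≤o : ∀ n → e n ≤ o n
    e≤o n = proj₂ (proj₂ (C≤C′ (e∈C n)))
    o≤e : ∀ n → o n ≤ e (suc n)
    o≤e n = proj₂ (proj₂ (C′≤C (o∈C′ n)))

    e-mono : Monotone e
    e-mono = monotone-stepwise e λ n → PO.trans (e≤o n) (o≤e n)
    o-mono : Monotone o
    o-mono = monotone-stepwise o λ n → PO.trans (o≤e n) (e≤o (suc n))

    s : X
    s = proj₁ (monotone⇒sup e e-mono)
    sup-e : IsSup e s
    sup-e = proj₂ (monotone⇒sup e e-mono)
    sup-o : IsSup o s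
    sup-o = (λ n → PO.trans (o≤e n) (proj₁ sup-e (suc n)))
          , λ x y x≰y s∈sep → let (m , eₘ∈sep) = proj₂ sup-e x y x≰y s∈sep
                              in m , D-increasing (sep-D x≰y) (e≤o m) eₘ∈sep

module Mq1Facts {X : Set} (_≤_ : X → X → Set) (E : X → X → Set) (eq : IsEquivalence E)
  (mq1 : ∀ {x y z} → E x y → y ≤ z → ∃ λ w → x ≤ w × E w z) where
  module EQ = IsEquivalence eq

  Img-increasing : ∀ {U} → Increasing _≤_ U → Increasing _≤_ (Img E U)
  Img-increasing increasing-U x≤y (u , u∈U , Eux) =
    let (w , u≤w , Ewy) = mq1 Eux x≤y in w , increasing-U u≤w u∈U , Ewy

  class-below : ∀ {x y z} → x ≤ z → E y z → E x ⊆ Down _≤_ (E y)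
  class-below x≤z Eyz Exc =
    let (w , c≤w , Ewz) = mq1 (EQ.sym Exc) x≤z in w , EQ.trans Eyz (EQ.sym Ewz) , c≤w

module MqSpaceFacts (lem : ExcludedMiddle 0ℓ) {X : Set} (Ω : Topology X) (_≤_ : X → X → Set)
  (po : IsPartialOrder _≡_ _≤_) (pr : Priestley Ω _≤_)
  (E : X → X → Set) (eq : IsEquivalence E)
  (mq1 : ∀ {x y z} → E x y → y ≤ z → ∃ λ w → x ≤ w × E w z)
  (E-class : ∀ x → Closed Ω (Img E ｛ x ｝)) (E-D : ∀ U → D Ω _≤_ U → D Ω _≤_ (Img E U)) where
  open Topology Ω
  open Priestley pr
  open PriestleyFacts lem Ω _≤_ po pr
  open Mq1Facts _≤_ E eq mq1

  class-closed : ∀ x → Closed Ω (E x)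
  class-closed x = Open-resp ((λ ∉Img Exs → ∉Img (x , refl , Exs)) , λ { ¬Exs (_ , refl , Exs) → ¬Exs Exs })
                             (E-class x)

  interlaced⇒E : ∀ {a y z t} → a ≤ z → E y z → y ≤ t → E a t → E a y
  interlaced⇒E {a} {y} a≤z Eyz y≤t Eat =
    let (s , Eas , Eys) = cofinal-closed-meet (class-closed a) (class-closed y) EQ.refl
                                              (class-below a≤z Eyz) (class-below y≤t Eat)
    in EQ.trans Eas (EQ.sym Eys)

  record DisjointNbhds (A : Subset X) (a y : X) : Set₁ where
    field
      nbhd-a nbhd-y : Subset X
      open-a        : Open nbhd-a
      open-y        : Open nbhd-y
      a∈nbhd        : a ∈ nbhd-a
      y∈nbhd        : y ∈ nbhd-y
      disjoint      : ∀ {c g} → c ∈ A → c ∈ nbhd-a → g ∈ nbhd-y → ¬ E c g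

  disjoint-nbhds : ∀ {A y} → Closed Ω A → y ∉ Img E A → ∀ a → DisjointNbhds A a y
  disjoint-nbhds {A} {y} closed-A y∉EA a with lem {a ∈ A}
  ... | no a∉A = record
    { nbhd-a = ∁ A ; nbhd-y = Whole ; open-a = closed-A ; open-y = Open-X
    ; a∈nbhd = a∉A ; y∈nbhd = lift tt ; disjoint = λ c∈A c∉A _ _ → c∉A c∈A }
  ... | yes a∈A with lem {∃ λ t → y ≤ t × E a t}
  ... | no y≰Ea =
    let (U , U-D , y∈U , U∩Ea=∅) = separate-from-closed y (E a) (class-closed a)
                                     (λ t Eat y≤t → y≰Ea (t , y≤t , Eat))
    in record
      { nbhd-a = ∁ (Img E U) ; nbhd-y = U ; open-a = D-closed (E-D U U-D) ; open-y = D-open U-D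
      ; a∈nbhd = λ (u , u∈U , Eua) → U∩Ea=∅ u u∈U (EQ.sym Eua) ; y∈nbhd = y∈U
      ; disjoint = λ _ c∉EU g∈U Ecg → c∉EU (_ , g∈U , EQ.sym Ecg) }
  ... | yes (t , y≤t , Eat) with lem {∃ λ z → a ≤ z × E y z}
  ... | no a≰Ey =
    let (U , U-D , a∈U , U∩Ey=∅) = separate-from-closed a (E y) (class-closed y)
                                     (λ z Eyz a≤z → a≰Ey (z , a≤z , Eyz))
    in record
      { nbhd-a = U ; nbhd-y = ∁ (Img E U) ; open-a = D-open U-D ; open-y = D-closed (E-D U U-D)
      ; a∈nbhd = a∈U ; y∈nbhd = λ (u , u∈U , Euy) → U∩Ey=∅ u u∈U (EQ.sym Euy)
      ; disjoint = λ _ c∈U g∉EU Ecg → g∉EU (_ , c∈U , Ecg) }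
  ... | yes (z , a≤z , Eyz) = ⊥-elim (y∉EA (a , a∈A , interlaced⇒E a≤z Eyz y≤t Eat))

  Img-closed : ∀ A → Closed Ω A → Closed Ω (Img E A)
  Img-closed A closed-A = Open-local _ λ y y∉EA →
    let open DisjointNbhds
        nbhds = disjoint-nbhds closed-A y∉EA
        (n , f , finite-cover) = compact (λ a → nbhd-a (nbhds a)) (λ a → open-a (nbhds a))
                                         (λ a → a , a∈nbhd (nbhds a))
    in ⋂ᶠ (λ k → nbhd-y (nbhds (f k))) , Open-⋂ᶠ _ (λ k → open-y (nbhds (f k))) ,
       (λ k → y∈nbhd (nbhds (f k))) ,
       λ g∈⋂ (c , c∈A , Ecg) → let (k , c∈nbhd) = finite-cover c
                               in disjoint (nbhds (f k)) c∈A c∈nbhd (g∈⋂ k) Ecg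

proposition3p1 : ExcludedMiddle 0ℓ →
    {X : Set} (Ω : Topology X) (_≤_ : X → X → Set) (E : X → X → Set) →
    X → IsPartialOrder _≡_ _≤_ → IsEquivalence E →
    MQSpace Ω _≤_ E ⇔ MKFrame Ω _≤_ E
proposition3p1 lem Ω _≤_ E _ po eq = mk⇔ mq⇒mk mk⇒mq
  where
  mq⇒mk : MQSpace Ω _≤_ E → MKFrame Ω _≤_ E
  mq⇒mk mq = record
    { mk1 = mq1
    ; mk2 = priestley
    ; mk3 = Img-closed
    ; mk4 = λ U U-D → D-open (E-D U U-D)
    ; mk5 = λ U U-D → proj₁ (mq2 U U-D)
    }
    where
    open MQSpace mq
    open QSpace qspace
    open MqSpaceFacts lem Ω _≤_ po priestley E eq mq1 E-class E-D
    open PriestleyFacts lem Ω _≤_ po priestley using (D-open)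

  mk⇒mq : MKFrame Ω _≤_ E → MQSpace Ω _≤_ E
  mk⇒mq mk = record
    { qspace = record
      { priestley = mk2
      ; E-D       = λ U U-D → (mk4 U U-D , mk3 U (D-closed U-D)) , Img-increasing (D-increasing U-D)
      ; E-class   = λ x → mk3 ｛ x ｝ (singleton-closed x)
      }
    ; mq1 = mk1
    ; mq2 = λ V V-D → mk5 V V-D , Down-closed (mk3 (∁ V) (Open⇒Closed-∁ (D-open V-D)))
    }
    where
    open MKFrame mk
    open PriestleyFacts lem Ω _≤_ po mk2
    open Mq1Facts _≤_ E eq mk1
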